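{- Let $r>0$ be an integer and let $T$ be a tournament containing an $r$-mountain $M$. Then $\overrightarrow{\omega}(T)\geq \lfloor \log_2 r\rfloor$.
   Context: A tournament is a finite directed graph with exactly one arc between each pair of distinct vertices. For a total ordering $<$ of $V(T)$, the backedge graph $B(T,<)$ is the graph on $V(T)$ with an edge $uv$ for every pair $u<v$ with $vu \in A(T)$; $\overrightarrow{\omega}(T)=\min_<\omega(B(T,<))$ over all total orderings. For disjoint vertex sets $X,Y$, $X\Rightarrow Y$ means $xy$ is an arc for all $x\in X,y\in Y$. Mountains are defined inductively inside a tournament $T$. A $1$-mountain is a single-vertex (induced) subtournament. For $r>0$, an arc $uv$ of $T$ is $r$-heavy if there is an $r$-mountain $M$ in $T$ with $V(M)\Rightarrow u$ and $v\Rightarrow V(M)$; otherwise it is $r$-light. For $r,s>0$, an $(r,s)$-clique is a set $K\subseteq V(T)$ of size $s$ such that every arc of $T[K]$ is $r$-heavy. An $(r,s)$-mountain is a minimal induced subtournament $T'$ of $T$ containing an $(r,s)$-clique (with heaviness certified by mountains inside $T'$). For $r>0$, an $(r+1)$-mountain means an $(r,r+1)$-mountain. -}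

module Defs where

open import Level using (0ℓ)
open import Data.Nat using (ℕ; zero; suc; _≥_)
open import Data.Nat.Logarithm using (⌊log₂_⌋)
open import Data.Fin using (Fin)
open import Data.Fin.Subset using (Subset; _∈_; _⊆_; _⊂_; ∣_∣; ⊤)
open import Data.Product using (Σ; ∃; _×_)
open import Data.Sum using (_⊎_)
open import Relation.Nullary using (¬_)
open import Relation.Binary.PropositionalEquality using (_≡_; _≢_)
open import Relation.Binary.Structures using (IsStrictTotalOrder)

record Tournament (n : ℕ) : Set₁ where
  field
    Arc     : Fin n → Fin n → Set
    irrefl  : ∀ u → ¬ Arc u u
    total   : ∀ u v → u ≢ v → Arc u v ⊎ Arc v u
    asym    : ∀ u v → Arc u v → ¬ Arc v u

module _ {n : ℕ} (T : Tournament n) where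
  open Tournament T

  -- Induced subtournaments of T are identified with their vertex sets.
  -- All notions below are relative to an ambient induced subtournament T[W].

  HeavyWrt : (Subset n → Subset n → Set) → Subset n → Fin n → Fin n → Set
  HeavyWrt Mtn W u v =
    ∃ λ S → Mtn W S × (∀ x → x ∈ S → Arc x u) × (∀ x → x ∈ S → Arc v x)

  CliqueWrt : (Subset n → Subset n → Set) → ℕ → Subset n → Subset n → Set
  CliqueWrt Mtn s W K =
    K ⊆ W × ∣ K ∣ ≡ s ×
    (∀ u v → u ∈ K → v ∈ K → Arc u v → HeavyWrt Mtn W u v)

  -- S is a minimal induced subtournament of T[W] containing such a clique,
  -- with heaviness certified by mountains inside T[S].
  MinimalCliqueHolderWrt : (Subset n → Subset n → Set) → ℕ → Subset n → Subset n → Set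
  MinimalCliqueHolderWrt Mtn s W S =
    S ⊆ W × (∃ λ K → CliqueWrt Mtn s S K) ×
    (∀ S′ → S′ ⊂ S → ¬ (∃ λ K → CliqueWrt Mtn s S′ K))

  -- MountainS k W S : S is a (k+1)-mountain of T[W].
  MountainS : ℕ → Subset n → Subset n → Set
  MountainS zero    W S = S ⊆ W × ∣ S ∣ ≡ 1
  MountainS (suc k) W S = MinimalCliqueHolderWrt (MountainS k) (suc (suc k)) W S

  IsMountain : ℕ → Subset n → Subset n → Set
  IsMountain zero    W S = Data.Empty.⊥ where import Data.Empty
  IsMountain (suc k) W S = MountainS k W S

  Heavy : ℕ → Subset n → Fin n → Fin n → Set
  Heavy r = HeavyWrt (IsMountain r)

  RSClique : ℕ → ℕ → Subset n → Subset n → Set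
  RSClique r = CliqueWrt (IsMountain r)

  RSMountain : ℕ → ℕ → Subset n → Subset n → Set
  RSMountain r = MinimalCliqueHolderWrt (IsMountain r)

  ContainsMountain : ℕ → Set
  ContainsMountain r = ∃ λ M → IsMountain r ⊤ M

  BackedgeClique : (Fin n → Fin n → Set) → Subset n → Set
  BackedgeClique _<_ K = ∀ u v → u ∈ K → v ∈ K → u < v → Arc v u

  BackedgeCliqueNumber≥ : (Fin n → Fin n → Set) → ℕ → Set
  BackedgeCliqueNumber≥ _<_ k = ∃ λ K → BackedgeClique _<_ K × ∣ K ∣ ≥ k

  OrderedCliqueNumber≥ : ℕ → Set₁
  OrderedCliqueNumber≥ k =
    (_<_ : Fin n → Fin n → Set) → IsStrictTotalOrder _≡_ _<_ →
    BackedgeCliqueNumber≥ _<_ k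

-- Forget the minimality of a mountain and keep only its nested heavy-arc
-- structure: a "range".  Ranges satisfy a Ramsey-type splitting lemma:
-- if every vertex of a k-range lies in A or in B, and a + b ≤ k, then it
-- contains an a-range inside A or a b-range inside B.  Given an ordering,
-- either the top clique of a k-range is already a backedge clique, or some
-- arc uv of it points forward (u before v).  Every vertex of the range
-- certifying uv comes after u or before v, so splitting with a = b = ⌊k/2⌋
-- yields a ⌊k/2⌋-range all of whose vertices are joined to u, or all to v,
-- by backedges.  Recursing and adding u (or v) gains one vertex per halving,
-- hence a backedge clique of size ⌊log₂ (k+1)⌋.
module Submission where

open import Level using (0ℓ)
open import Function using (_∘_; const)
open import Data.Nat using (ℕ; zero; suc; _+_; _^_; _≤_; _<_; _>_; z≤n; s≤s; ⌊_/2⌋; _<?_)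
open import Data.Nat.Properties
  using (≤-trans; ≤-reflexive; <-≤-trans; ≤-pred; ≮⇒≥; +-suc; +-comm; +-mono-≤; +-monoˡ-≤;
         +-monoʳ-≤; +-cancelˡ-<; m≤m+n; m≤n+m∸n; m^n>0; ⌊n/2⌋≤n; ⌊n/2⌋≤⌈n/2⌉; ⌊n/2⌋+⌈n/2⌉≡n;
         module ≤-Reasoning)
open import Data.Nat.Induction using (<-rec)
open import Data.Nat.Logarithm using (⌊log₂_⌋; ⌊log₂⌊n/2⌋⌋≡⌊log₂n⌋∸1; ⌊log₂[2^n]⌋≡n; ⌊log₂⌋-mono-≤)
open import Data.Fin.Base using (Fin; zero; suc)
open import Data.Fin.Properties using (_≟_)
open import Data.Fin.Subset
  using (Subset; _∈_; _∉_; _⊆_; ∣_∣; ∁; _∪_; ⁅_⁆; ⊥; Lift; Nonempty; inside; outside)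
  renaming (_∩_ to _∩ˢ_)
open import Data.Fin.Subset.Properties
  using (_∈?_; ∉⊥; x∈⁅x⁆; x∈⁅y⁆⇒x≡y; p⊆p∪q; q⊆p∪q; x∈p∪q⁻; p∩q⊆p; p∩q⊆q; p⊂q⇒∣p∣<∣q∣)
open import Data.Vec.Base using ([]; _∷_; here; there)
open import Data.Product using (∃; ∃₂; _×_; _,_; proj₁; proj₂; map₁)
open import Data.Sum as Sum using (_⊎_; inj₁; inj₂)
open import Data.Empty using (⊥-elim)
open import Relation.Nullary using (Dec; yes; no)
open import Relation.Unary as U using (Pred; Satisfiable; _∩_)
open import Relation.Binary.PropositionalEquality using (_≡_; _≢_; refl; sym; trans; cong; subst)
open import Relation.Binary.Structures using (IsStrictTotalOrder)
open import Relation.Binary.Definitions using (Cotransitive; tri<; tri≈; tri>)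

open import Defs

∀⊎ : ∀ {m} {P : Fin m → Set} {Q : Set} → (∀ i → P i ⊎ Q) → (∀ i → P i) ⊎ Q
∀⊎ {zero}  f = inj₁ λ ()
∀⊎ {suc m} f with f zero | ∀⊎ (f ∘ suc)
... | inj₂ q  | _       = inj₂ q
... | inj₁ _  | inj₂ q  = inj₂ q
... | inj₁ p₀ | inj₁ ps = inj₁ λ { zero → p₀ ; (suc i) → ps i }

decide-premise : ∀ {A B Q : Set} → Dec A → (A → B ⊎ Q) → (A → B) ⊎ Q
decide-premise (yes a) f = Sum.map₁ (λ b _ → b) (f a)
decide-premise (no ¬a) _ = inj₁ (⊥-elim ∘ ¬a)

pigeonhole : ∀ a b x y → a + b < x + y → a < x ⊎ b < y
pigeonhole a b x y a+b<x+y with a <? x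
... | yes a<x = inj₁ a<x
... | no  a≮x = inj₂ (+-cancelˡ-< a b y (<-≤-trans a+b<x+y (+-monoˡ-≤ y (≮⇒≥ a≮x))))

⌊n/2⌋+⌊n/2⌋≤n : ∀ n → ⌊ n /2⌋ + ⌊ n /2⌋ ≤ n
⌊n/2⌋+⌊n/2⌋≤n n = subst (⌊ n /2⌋ + ⌊ n /2⌋ ≤_) (⌊n/2⌋+⌈n/2⌉≡n n) (+-monoʳ-≤ ⌊ n /2⌋ (⌊n/2⌋≤⌈n/2⌉ n))

n≤2^n : ∀ n → n ≤ 2 ^ n
n≤2^n zero    = z≤n
n≤2^n (suc n) = +-mono-≤ (m^n>0 2 n) (≤-trans (n≤2^n n) (m≤m+n (2 ^ n) 0))

⌊log₂n⌋≤n : ∀ n → ⌊log₂ n ⌋ ≤ n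
⌊log₂n⌋≤n n = subst (⌊log₂ n ⌋ ≤_) (⌊log₂[2^n]⌋≡n n) (⌊log₂⌋-mono-≤ (n≤2^n n))

-- ⌊ (2 + n) /2⌋ reduces to 1 + ⌊ n /2⌋.
⌊log₂[2+n]⌋≤1+⌊log₂[1+⌊n/2⌋]⌋ : ∀ n → ⌊log₂ suc (suc n) ⌋ ≤ suc ⌊log₂ suc ⌊ n /2⌋ ⌋
⌊log₂[2+n]⌋≤1+⌊log₂[1+⌊n/2⌋]⌋ n =
  subst (λ m → ⌊log₂ suc (suc n) ⌋ ≤ suc m) (sym (⌊log₂⌊n/2⌋⌋≡⌊log₂n⌋∸1 (suc (suc n))))
    (m≤n+m∸n ⌊log₂ suc (suc n) ⌋ 1)

Nonempty-∣p∣>0 : ∀ {n} (p : Subset n) → ∣ p ∣ > 0 → Nonempty p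
Nonempty-∣p∣>0 (inside  ∷ p) _ = zero , here
Nonempty-∣p∣>0 (outside ∷ p) ∣p∣>0 with Nonempty-∣p∣>0 p ∣p∣>0
... | x , x∈p = suc x , there x∈p

∣p∩q∣+∣p∩∁q∣≡∣p∣ : ∀ {n} (p q : Subset n) → ∣ p ∩ˢ q ∣ + ∣ p ∩ˢ ∁ q ∣ ≡ ∣ p ∣
∣p∩q∣+∣p∩∁q∣≡∣p∣ []            []            = refl
∣p∩q∣+∣p∩∁q∣≡∣p∣ (outside ∷ p) (_       ∷ q) = ∣p∩q∣+∣p∩∁q∣≡∣p∣ p q
∣p∩q∣+∣p∩∁q∣≡∣p∣ (inside  ∷ p) (inside  ∷ q) = cong suc (∣p∩q∣+∣p∩∁q∣≡∣p∣ p q)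
∣p∩q∣+∣p∩∁q∣≡∣p∣ (inside  ∷ p) (outside ∷ q) =
  trans (+-suc ∣ p ∩ˢ q ∣ ∣ p ∩ˢ ∁ q ∣) (cong suc (∣p∩q∣+∣p∩∁q∣≡∣p∣ p q))

∣p∣<∣⁅x⁆∪p∣ : ∀ {n} {x : Fin n} {p : Subset n} → x ∉ p → ∣ p ∣ < ∣ ⁅ x ⁆ ∪ p ∣
∣p∣<∣⁅x⁆∪p∣ {x = x} {p} x∉p = p⊂q⇒∣p∣<∣q∣ (q⊆p∪q ⁅ x ⁆ p , x , p⊆p∪q p (x∈⁅x⁆ x) , x∉p)

leftPart : ∀ {n} {A B : Pred (Fin n) 0ℓ} → (∀ x → A x ⊎ B x) → Subset n
leftPart {zero}  _     = []
leftPart {suc n} cover = Sum.[ const inside , const outside ]′ (cover zero) ∷ leftPart (cover ∘ suc)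

∈-leftPart⁻ : ∀ {n} {A B : Pred (Fin n) 0ℓ} (cover : ∀ x → A x ⊎ B x) → Lift A (leftPart cover)
∈-leftPart⁻ cover {zero} x∈L with cover zero | x∈L
... | inj₁ a | _ = a
... | inj₂ _ | ()
∈-leftPart⁻ cover {suc x} (there x∈L) = ∈-leftPart⁻ (cover ∘ suc) x∈L

∈-∁leftPart⁻ : ∀ {n} {A B : Pred (Fin n) 0ℓ} (cover : ∀ x → A x ⊎ B x) → Lift B (∁ (leftPart cover))
∈-∁leftPart⁻ cover {zero} x∈∁L with cover zero | x∈∁L
... | inj₁ _ | ()
... | inj₂ b | _ = b
∈-∁leftPart⁻ cover {suc x} (there x∈∁L) = ∈-∁leftPart⁻ (cover ∘ suc) x∈∁L

module _ {n : ℕ} (T : Tournament n) where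
  open Tournament T

  arc? : ∀ u v → Dec (Arc u v)
  arc? u v with u ≟ v
  ... | yes refl = no (irrefl u)
  ... | no  u≢v  = Sum.[ yes , no ∘ asym v u ]′ (total u v u≢v)

  Wedge : Pred (Fin n) 0ℓ → Fin n → Fin n → Pred (Fin n) 0ℓ
  Wedge R u v = R ∩ (λ x → Arc x u) ∩ (λ x → Arc v x)

  -- Range k R abstracts a (k+1)-mountain whose vertices satisfy R; the top
  -- clique K may be larger than k + 2 and nothing is required to be minimal.
  Range : ℕ → Pred (Fin n) 0ℓ → Set
  Frame : ℕ → Pred (Fin n) 0ℓ → Subset n → Set

  Range zero    R = Satisfiable R
  Range (suc k) R = ∃ λ K → suc (suc k) ≤ ∣ K ∣ × Frame k R K

  Frame k R K = Lift R K × (∀ {u v} → u ∈ K → v ∈ K → Arc u v → Range k (Wedge R u v))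

  Range-mono : ∀ k {R R′} → R U.⊆ R′ → Range k R → Range k R′
  Range-mono zero    R⊆R′ (x , r)                 = x , R⊆R′ r
  Range-mono (suc k) R⊆R′ (K , size , inR , arcs) =
    K , size , (λ x∈K → R⊆R′ (inR x∈K)) , λ u∈K v∈K uv → Range-mono k (map₁ R⊆R′) (arcs u∈K v∈K uv)

  mountain⊆ : ∀ k {W S} → MountainS T k W S → S ⊆ W
  mountain⊆ zero    = proj₁
  mountain⊆ (suc k) = proj₁

  mountain⇒Range : ∀ k {W S} → MountainS T k W S → Range k (_∈ S)
  mountain⇒Range zero    {S = S} (_ , ∣S∣≡1) = Nonempty-∣p∣>0 S (≤-reflexive (sym ∣S∣≡1))
  mountain⇒Range (suc k) {S = S} (_ , (K , K⊆S , ∣K∣≡ , heavy) , _) =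
    K , ≤-reflexive (sym ∣K∣≡) , K⊆S , λ u∈K v∈K uv → heavy⇒Range (heavy _ _ u∈K v∈K uv)
    where
    heavy⇒Range : ∀ {u v} → HeavyWrt T (MountainS T k) S u v → Range k (Wedge (_∈ S) u v)
    heavy⇒Range (S′ , S′-mountain , S′⇒u , v⇒S′) =
      Range-mono k (λ {x} x∈S′ → mountain⊆ k S′-mountain x∈S′ , S′⇒u x x∈S′ , v⇒S′ x x∈S′)
        (mountain⇒Range k S′-mountain)

  Range-suc⊎ : ∀ {c R} {Z : Set} K → suc (suc c) ≤ ∣ K ∣ → Lift R K →
    (∀ {u v} → u ∈ K → v ∈ K → Arc u v → Range c (Wedge R u v) ⊎ Z) → Range (suc c) R ⊎ Z
  Range-suc⊎ K size inR arc⇒ =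
    Sum.map₁ (λ arcs → K , size , inR , λ {u} {v} → arcs u v)
      (∀⊎ λ u → ∀⊎ λ v → decide-premise (u ∈? K) λ u∈K → decide-premise (v ∈? K) λ v∈K →
        decide-premise (arc? u v) (arc⇒ u∈K v∈K))

  RangeSplit : ℕ → Set₁
  RangeSplit k = ∀ {R A B : Pred (Fin n) 0ℓ} → (∀ x → A x ⊎ B x) →
    ∀ a b → a + b ≤ k → Range k R → Range a (R ∩ A) ⊎ Range b (R ∩ B)

  -- One case of the induction step: a part Q of the top clique lying in A is
  -- large enough, and each arc of Q either inherits an a-range in A or
  -- already exhibits a b-range in B.
  Range-split-via : ∀ {k R A B a b K Q} → RangeSplit k → (∀ x → A x ⊎ B x) → a + b ≤ suc k →
    Frame k R K → Q ⊆ K → Lift A Q → a < ∣ Q ∣ → Range a (R ∩ A) ⊎ Range b (R ∩ B)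
  Range-split-via {a = zero} {Q = Q} _ _ _ (inR , _) Q⊆K inA ∣Q∣>0 with Nonempty-∣p∣>0 Q ∣Q∣>0
  ... | x , x∈Q = inj₁ (x , inR (Q⊆K x∈Q) , inA x∈Q)
  Range-split-via {a = suc a} {b} {Q = Q} split cover a+b≤ (inR , arcs) Q⊆K inA a<∣Q∣ =
    Range-suc⊎ Q a<∣Q∣ (λ x∈Q → inR (Q⊆K x∈Q) , inA x∈Q) λ u∈Q v∈Q uv →
      Sum.map (Range-mono a λ ((r , wedge) , α) → (r , α) , wedge) (Range-mono b (map₁ proj₁))
        (split cover a b (≤-pred a+b≤) (arcs (Q⊆K u∈Q) (Q⊆K v∈Q) uv))

  Range-split : ∀ k → RangeSplit k
  Range-split zero cover zero    zero    _  (x , r) =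
    Sum.map (λ α → x , r , α) (λ β → x , r , β) (cover x)
  Range-split zero cover zero    (suc b) ()
  Range-split zero cover (suc a) b       ()
  Range-split (suc k) cover a b a+b≤ (K , size , frame)
    with pigeonhole a b ∣ K ∩ˢ leftPart cover ∣ ∣ K ∩ˢ ∁ (leftPart cover) ∣ a+b<∣K∣
    where
    open ≤-Reasoning
    a+b<∣K∣ : a + b < ∣ K ∩ˢ leftPart cover ∣ + ∣ K ∩ˢ ∁ (leftPart cover) ∣
    a+b<∣K∣ = begin-strict
      a + b  <⟨ s≤s a+b≤ ⟩
      suc (suc k) ≤⟨ size ⟩
      ∣ K ∣ ≡⟨ sym (∣p∩q∣+∣p∩∁q∣≡∣p∣ K (leftPart cover)) ⟩
      ∣ K ∩ˢ leftPart cover ∣ + ∣ K ∩ˢ ∁ (leftPart cover) ∣ ∎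
  ... | inj₁ a< = Range-split-via (Range-split k) cover a+b≤ frame
          (p∩q⊆p K _) (λ x∈ → ∈-leftPart⁻ cover (p∩q⊆q K _ x∈)) a<
  ... | inj₂ b< = Sum.swap (Range-split-via (Range-split k) (Sum.swap ∘ cover)
          (subst (_≤ suc k) (+-comm a b) a+b≤) frame
          (p∩q⊆p K _) (λ x∈ → ∈-∁leftPart⁻ cover (p∩q⊆q K _ x∈)) b<)

  module _ {_≺_ : Fin n → Fin n → Set} (≺-sto : IsStrictTotalOrder _≡_ _≺_) where
    open IsStrictTotalOrder ≺-sto using (compare)
      renaming (_<?_ to _≺?_; trans to ≺-trans; irrefl to ≺-irrefl; asym to ≺-asym)

    ≺-cotrans : Cotransitive _≺_
    ≺-cotrans {u} {v} u≺v x with compare u x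
    ... | tri< u≺x _ _ = inj₁ u≺x
    ... | tri≈ _ refl _ = inj₂ u≺v
    ... | tri> _ _ x≺u = inj₂ (≺-trans x≺u u≺v)

    BackedgeClique⊎forwardArc : ∀ K →
      BackedgeClique T _≺_ K ⊎ ∃₂ λ u v → u ∈ K × v ∈ K × u ≺ v × Arc u v
    BackedgeClique⊎forwardArc K =
      ∀⊎ λ u → ∀⊎ λ v → decide-premise (u ∈? K) λ u∈K → decide-premise (v ∈? K) λ v∈K →
        decide-premise (u ≺? v) λ u≺v →
          Sum.swap (Sum.map₁ (λ uv → u , v , u∈K , v∈K , u≺v , uv)
            (total u v λ { refl → ≺-irrefl refl u≺v }))

    Backedge : Fin n → Fin n → Set
    Backedge w x = (w ≺ x → Arc x w) × (x ≺ w → Arc w x)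

    BackedgeClique-∪ : ∀ {w C} → BackedgeClique T _≺_ C → Lift (Backedge w) C →
      BackedgeClique T _≺_ (⁅ w ⁆ ∪ C)
    BackedgeClique-∪ {w} {C} clique joined x y x∈ y∈ x≺y with x∈p∪q⁻ ⁅ w ⁆ C x∈ | x∈p∪q⁻ ⁅ w ⁆ C y∈
    ... | inj₁ x∈⁅w⁆ | inj₁ y∈⁅w⁆ =
      ⊥-elim (≺-irrefl (trans (x∈⁅y⁆⇒x≡y w x∈⁅w⁆) (sym (x∈⁅y⁆⇒x≡y w y∈⁅w⁆))) x≺y)
    ... | inj₁ x∈⁅w⁆ | inj₂ y∈C with refl ← x∈⁅y⁆⇒x≡y w x∈⁅w⁆ = proj₁ (joined y∈C) x≺y
    ... | inj₂ x∈C | inj₁ y∈⁅w⁆ with refl ← x∈⁅y⁆⇒x≡y w y∈⁅w⁆ = proj₂ (joined x∈C) x≺y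
    ... | inj₂ x∈C | inj₂ y∈C = clique x y x∈C y∈C x≺y

    BackedgeClique≥ : ℕ → Pred (Fin n) 0ℓ → Set
    BackedgeClique≥ t R = ∃ λ C → Lift R C × BackedgeClique T _≺_ C × t ≤ ∣ C ∣

    BackedgeClique≥-weaken : ∀ {s t R} → s ≤ t → BackedgeClique≥ t R → BackedgeClique≥ s R
    BackedgeClique≥-weaken s≤t (C , inR , clique , t≤∣C∣) = C , inR , clique , ≤-trans s≤t t≤∣C∣

    BackedgeClique≥-extend : ∀ {t R R′ w} → R w → R′ U.⊆ R ∩ (_≢ w) ∩ Backedge w →
      BackedgeClique≥ t R′ → BackedgeClique≥ (suc t) R
    BackedgeClique≥-extend {R = R} {w = w} Rw R′⊆ (C , inR′ , clique , t≤∣C∣) =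
      ⁅ w ⁆ ∪ C , inR , BackedgeClique-∪ clique (λ x∈C → proj₂ (proj₂ (R′⊆ (inR′ x∈C)))) ,
      ≤-trans (s≤s t≤∣C∣) (∣p∣<∣⁅x⁆∪p∣ λ w∈C → proj₁ (proj₂ (R′⊆ (inR′ w∈C))) refl)
      where
      inR : Lift R (⁅ w ⁆ ∪ C)
      inR x∈ with x∈p∪q⁻ ⁅ w ⁆ C x∈
      ... | inj₁ x∈⁅w⁆ = subst R (sym (x∈⁅y⁆⇒x≡y w x∈⁅w⁆)) Rw
      ... | inj₂ x∈C = proj₁ (R′⊆ (inR′ x∈C))

    Wedge∩after⊆Backedge : ∀ {R u v} → Wedge R u v ∩ (u ≺_) U.⊆ R ∩ (_≢ u) ∩ Backedge u
    Wedge∩after⊆Backedge ((r , x→u , _) , u≺x) =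
      r , (λ { refl → ≺-irrefl refl u≺x }) , (λ _ → x→u) , ⊥-elim ∘ ≺-asym u≺x

    Wedge∩before⊆Backedge : ∀ {R u v} → Wedge R u v ∩ (_≺ v) U.⊆ R ∩ (_≢ v) ∩ Backedge v
    Wedge∩before⊆Backedge ((r , _ , v→x) , x≺v) =
      r , (λ { refl → ≺-irrefl refl x≺v }) , ⊥-elim ∘ ≺-asym x≺v , (λ _ → v→x)

    Range⇒BackedgeClique≥ : ∀ k {R} → Range k R → BackedgeClique≥ ⌊log₂ suc k ⌋ R
    Range⇒BackedgeClique≥ = <-rec _ step
      where
      step : ∀ k → (∀ {j} → j < k → ∀ {R} → Range j R → BackedgeClique≥ ⌊log₂ suc j ⌋ R) →
        ∀ {R} → Range k R → BackedgeClique≥ ⌊log₂ suc k ⌋ R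
      step zero _ _ = ⊥ , (λ x∈⊥ → ⊥-elim (∉⊥ x∈⊥)) , (λ _ _ x∈⊥ → ⊥-elim (∉⊥ x∈⊥)) , z≤n
      step (suc k) rec {R} (K , size , inR , arcs) with BackedgeClique⊎forwardArc K
      ... | inj₁ clique = K , inR , clique , ≤-trans (⌊log₂n⌋≤n (suc (suc k))) size
      ... | inj₂ (u , v , u∈K , v∈K , u≺v , uv) =
        Sum.[ extend-by (inR u∈K) (Wedge∩after⊆Backedge {R})
            , extend-by (inR v∈K) (Wedge∩before⊆Backedge {R}) ]′
          (Range-split k {Wedge R u v} (≺-cotrans u≺v) ⌊ k /2⌋ ⌊ k /2⌋ (⌊n/2⌋+⌊n/2⌋≤n k)
            (arcs u∈K v∈K uv))
        where
        extend-by : ∀ {w R′} → R w → R′ U.⊆ R ∩ (_≢ w) ∩ Backedge w →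
          Range ⌊ k /2⌋ R′ → BackedgeClique≥ ⌊log₂ suc (suc k) ⌋ R
        extend-by Rw R′⊆ range = BackedgeClique≥-weaken (⌊log₂[2+n]⌋≤1+⌊log₂[1+⌊n/2⌋]⌋ k)
          (BackedgeClique≥-extend Rw R′⊆ (rec (s≤s (⌊n/2⌋≤n k)) range))

lemma4p3 : (r : ℕ) → r > 0 → (n : ℕ) → (T : Tournament n) →
    ContainsMountain T r → OrderedCliqueNumber≥ T ⌊log₂ r ⌋
lemma4p3 zero    () _ _ _
lemma4p3 (suc k) _  n T (M , M-mountain) _≺_ ≺-sto
  with C , _ , clique , size ← Range⇒BackedgeClique≥ T ≺-sto k (mountain⇒Range T k M-mountain)
  = C , clique , size
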